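{- Let $K\ge1$ be an integer. If $3\mid K$, then $\pi_K(3)=2$; otherwise $\pi_K(3)=8$.
   Context: The $K$-Fibonacci sequence is $F_{K,0}=0$, $F_{K,1}=1$, $F_{K,n}=K F_{K,n-1}+F_{K,n-2}$; for an integer $m>1$, $\pi_K(m)$ is the length of its shortest period modulo $m$. -}

module Defs where

open import Data.Nat using (ℕ; zero; suc; _+_; _*_; _<_; _≤_; _%_; NonZero)
open import Data.Product using (_×_)
open import Relation.Binary.PropositionalEquality using (_≡_)

kfib : ℕ → ℕ → ℕ
kfib K zero = 0
kfib K (suc zero) = 1
kfib K (suc (suc n)) = K * kfib K (suc n) + kfib K n

IsPeriod : (K m : ℕ) .{{_ : NonZero m}} → ℕ → Set
IsPeriod K m p = 0 < p × (∀ n → kfib K (n + p) % m ≡ kfib K n % m)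

IsPisano : (K m : ℕ) .{{_ : NonZero m}} → ℕ → Set
IsPisano K m p = IsPeriod K m p × (∀ q → IsPeriod K m q → p ≤ q)

{-# OPTIONS --safe #-}
module Submission where

-- Modulo m the K-Fibonacci sequence depends only on K mod m, and it is a
-- second-order recurrence, so it is periodic with period p as soon as the
-- pair (F p, F (p+1)) returns to the initial pair (0, 1). For m = 3 this
-- leaves the residues K = 0, 1, 2, where the first return happens at
-- p = 2, 8, 8 respectively; minimality is a finite check of the earlier p.

open import Defs
open import Data.Nat using (ℕ; zero; suc; _+_; _*_; _%_; _<_; _≤_; _<?_; _≟_; NonZero; z≤n; s≤s)
open import Data.Nat.Properties using (≮⇒≥; allUpTo?)
open import Data.Nat.DivMod using (%-distribˡ-+; %-distribˡ-*; m%n%n≡m%n; m%n<n)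
open import Data.Nat.Divisibility using (_∣_; n∣m⇒m%n≡0; m%n≡0⇒n∣m)
open import Data.Product using (_×_; _,_)
open import Data.Empty using (⊥-elim)
open import Function using (_∘_)
open import Relation.Nullary using (¬_; Dec; ¬?; _×-dec_)
open import Relation.Nullary.Decidable using (from-yes)
open import Relation.Binary.PropositionalEquality using (_≡_; _≢_; refl; sym; trans; cong; cong₂; subst; module ≡-Reasoning)

*+-%-cong : ∀ {k k′ a a′ b b′} m .{{_ : NonZero m}} →
            k % m ≡ k′ % m → a % m ≡ a′ % m → b % m ≡ b′ % m →
            (k * a + b) % m ≡ (k′ * a′ + b′) % m
*+-%-cong {k} {k′} {a} {a′} {b} {b′} m k≡ a≡ b≡ = begin
  (k * a + b) % m                          ≡⟨ %-distribˡ-+ (k * a) b m ⟩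
  ((k * a) % m + b % m) % m                ≡⟨ cong (λ x → (x + b % m) % m) (%-distribˡ-* k a m) ⟩
  ((k % m * (a % m)) % m + b % m) % m      ≡⟨ cong₂ (λ x y → (x % m + y) % m) (cong₂ _*_ k≡ a≡) b≡ ⟩
  ((k′ % m * (a′ % m)) % m + b′ % m) % m   ≡⟨ cong (λ x → (x + b′ % m) % m) (%-distribˡ-* k′ a′ m) ⟨
  ((k′ * a′) % m + b′ % m) % m             ≡⟨ %-distribˡ-+ (k′ * a′) b′ m ⟨
  (k′ * a′ + b′) % m                       ∎
  where open ≡-Reasoning

kfib-%-cong : ∀ {K K′} m .{{_ : NonZero m}} → K % m ≡ K′ % m →
              ∀ n → kfib K n % m ≡ kfib K′ n % m
kfib-%-cong m K≡ zero          = refl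
kfib-%-cong m K≡ (suc zero)    = refl
kfib-%-cong m K≡ (suc (suc n)) =
  *+-%-cong m K≡ (kfib-%-cong m K≡ (suc n)) (kfib-%-cong m K≡ n)

isPeriod-cong : ∀ {K K′} m .{{_ : NonZero m}} → K % m ≡ K′ % m →
                ∀ {p} → IsPeriod K m p → IsPeriod K′ m p
isPeriod-cong m K≡ (0<p , periodic) = 0<p , λ n →
  trans (sym (kfib-%-cong m K≡ (n + _))) (trans (periodic n) (kfib-%-cong m K≡ n))

isPisano-cong : ∀ {K K′} m .{{_ : NonZero m}} → K % m ≡ K′ % m →
                ∀ {p} → IsPisano K m p → IsPisano K′ m p
isPisano-cong m K≡ (period , least) =
  isPeriod-cong m K≡ period , λ q → least q ∘ isPeriod-cong m (sym K≡)

ReturnsToStart : (K m : ℕ) .{{_ : NonZero m}} → ℕ → Set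
ReturnsToStart K m p = kfib K p % m ≡ kfib K 0 % m × kfib K (suc p) % m ≡ kfib K 1 % m

returnsToStart? : ∀ K m .{{_ : NonZero m}} p → Dec (ReturnsToStart K m p)
returnsToStart? K m p = (kfib K p % m ≟ kfib K 0 % m) ×-dec (kfib K (suc p) % m ≟ kfib K 1 % m)

returnsToStart⇒periodic : ∀ {K m} .{{_ : NonZero m}} {p} → ReturnsToStart K m p →
                          ∀ n → kfib K (n + p) % m ≡ kfib K n % m
returnsToStart⇒periodic         (F₀≡ , F₁≡) zero          = F₀≡
returnsToStart⇒periodic         (F₀≡ , F₁≡) (suc zero)    = F₁≡
returnsToStart⇒periodic {K} {m} returns     (suc (suc n)) = *+-%-cong {K} m refl
  (returnsToStart⇒periodic returns (suc n)) (returnsToStart⇒periodic returns n)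

NoEarlierReturn : (K m : ℕ) .{{_ : NonZero m}} → ℕ → Set
NoEarlierReturn K m p = ∀ {q} → q < p → ¬ (0 < q × ReturnsToStart K m q)

noEarlierReturn? : ∀ K m .{{_ : NonZero m}} p → Dec (NoEarlierReturn K m p)
noEarlierReturn? K m = allUpTo? (λ q → ¬? ((0 <? q) ×-dec returnsToStart? K m q))

firstReturn⇒isPisano : ∀ {K m} .{{_ : NonZero m}} {p} → 0 < p → ReturnsToStart K m p →
                       NoEarlierReturn K m p → IsPisano K m p
firstReturn⇒isPisano 0<p returns noEarlier =
  (0<p , returnsToStart⇒periodic returns) ,
  λ q (0<q , periodic) → ≮⇒≥ λ q<p → noEarlier q<p (0<q , periodic 0 , periodic 1)

isPisano-0-3-2 : IsPisano 0 3 2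
isPisano-0-3-2 = firstReturn⇒isPisano (s≤s z≤n) (refl , refl) (from-yes (noEarlierReturn? 0 3 2))

isPisano-nonzero-residue-3-8 : ∀ r → r < 3 → r ≢ 0 → IsPisano r 3 8
isPisano-nonzero-residue-3-8 0 _ r≢0 = ⊥-elim (r≢0 refl)
isPisano-nonzero-residue-3-8 1 _ _   =
  firstReturn⇒isPisano (s≤s z≤n) (refl , refl) (from-yes (noEarlierReturn? 1 3 8))
isPisano-nonzero-residue-3-8 2 _ _   =
  firstReturn⇒isPisano (s≤s z≤n) (refl , refl) (from-yes (noEarlierReturn? 2 3 8))
isPisano-nonzero-residue-3-8 (suc (suc (suc _))) (s≤s (s≤s (s≤s ()))) _

theorem2p10 : (K : ℕ) → 1 ≤ K →
    (3 ∣ K → IsPisano K 3 2) × (¬ (3 ∣ K) → IsPisano K 3 8)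
theorem2p10 K _ = divisible , notDivisible
  where
  fromResidue : ∀ {p} → IsPisano (K % 3) 3 p → IsPisano K 3 p
  fromResidue = isPisano-cong 3 (m%n%n≡m%n K 3)

  divisible : 3 ∣ K → IsPisano K 3 2
  divisible 3∣K = fromResidue (subst (λ r → IsPisano r 3 2) (sym (n∣m⇒m%n≡0 K 3 3∣K)) isPisano-0-3-2)

  notDivisible : ¬ (3 ∣ K) → IsPisano K 3 8
  notDivisible 3∤K = fromResidue
    (isPisano-nonzero-residue-3-8 (K % 3) (m%n<n K 3) (3∤K ∘ m%n≡0⇒n∣m K 3))
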